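{- Let $r \geq 1$ be an integer and let $b > 1$ be an integer with $\gcd(2,b) = 1$ such that $2^r b^2$ is almost perfect. Then $$\left(\sigma(b^2) - b^2\right) \mid \left(b^2 - 1\right).$$
   Context: $\sigma(x)$ denotes the sum of the positive divisors of $x$. A positive integer $y$ is almost perfect if $\sigma(y) = 2y - 1$. -}

module Defs where

open import Data.Nat using (ℕ; zero; suc; _+_; _*_; _∸_; _<_)
open import Data.Nat.Divisibility using (_∣?_)
open import Data.List using (List; filter; upTo; map)
open import Data.Nat.ListAction using (sum)
open import Data.Product using (_×_)
open import Relation.Binary.PropositionalEquality using (_≡_)

divisors : ℕ → List ℕ
divisors n = filter (_∣? n) (map suc (upTo n))

σ : ℕ → ℕ
σ n = sum (divisors n)

AlmostPerfect : ℕ → Set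
AlmostPerfect y = (0 < y) × (σ y ≡ 2 * y ∸ 1)

module Submission where

-- Write B = b², which is odd because gcd(2, b) = 1.  The proof rests on the
-- multiplicativity of σ at the prime 2:  for odd m,
--     σ(2^k m) + σ(m) = 2^(k+1) σ(m),   i.e.  σ(2^k m) = (2^(k+1) − 1) σ(m).
-- With P = 2^(r+1) = q + 1 the almost-perfect equation σ(2^r B) + 1 = P B
-- and the identity σ(2^r B) = q σ(B) give q σ(B) + 1 = B + q B, hence
-- q (σ(B) − B) = B − 1, which is the divisibility claimed.

open import Defs
open import Data.Nat using (ℕ; _*_; _∸_; _^_; _≤_; _<_)
open import Data.Nat.Divisibility using (_∣_)
open import Data.Nat.GCD using (gcd)
open import Relation.Binary.PropositionalEquality using (_≡_)

open import Data.Nat using (zero; suc; _+_; NonZero; ≢-nonZero; z≤n; s≤s)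
open import Data.Nat.Properties
open import Data.Nat.Divisibility
  using (_∣?_; _∤_; divides; ∣-trans; n∣m*n; *-monoʳ-∣; *-cancelˡ-∣; >⇒∤; ∣-refl)
open import Data.Nat.Coprimality using (Coprime; gcd≡1⇒coprime; coprime-divisor)
open import Data.Nat.Primality using (irreducible[2])
open import Data.Nat.ListAction using (sum)
open import Data.Nat.Solver using (module +-*-Solver)
open import Data.List using (filter; applyUpTo)
open import Data.List.Properties using (map-applyUpTo)
open import Data.Bool using (if_then_else_; true; false)
open import Data.Product using (_,_)
open import Data.Sum using (inj₁; inj₂)
open import Relation.Nullary using (does; yes; no; contradiction)
open import Relation.Binary.PropositionalEquality
  using (refl; sym; trans; cong; cong₂; subst; module ≡-Reasoning)
open import Function using (_∘_)

open ≡-Reasoning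

sumBelow : ℕ → (ℕ → ℕ) → ℕ
sumBelow zero    f = 0
sumBelow (suc n) f = f 0 + sumBelow n (f ∘ suc)

syntax sumBelow n (λ i → e) = ∑[ i < n ] e

sum-cong : ∀ n {f g : ℕ → ℕ} → (∀ i → i < n → f i ≡ g i) → sumBelow n f ≡ sumBelow n g
sum-cong zero    f≡g = refl
sum-cong (suc n) f≡g =
  cong₂ _+_ (f≡g 0 (s≤s z≤n)) (sum-cong n (λ i i<n → f≡g (suc i) (s≤s i<n)))

sum-zero : ∀ n {f : ℕ → ℕ} → (∀ i → i < n → f i ≡ 0) → sumBelow n f ≡ 0
sum-zero zero    f≡0 = refl
sum-zero (suc n) f≡0 =
  cong₂ _+_ (f≡0 0 (s≤s z≤n)) (sum-zero n (λ i i<n → f≡0 (suc i) (s≤s i<n)))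

sum-++ : ∀ n k (f : ℕ → ℕ) → sumBelow (n + k) f ≡ sumBelow n f + ∑[ i < k ] f (n + i)
sum-++ zero    k f = refl
sum-++ (suc n) k f = trans (cong (f 0 +_) (sum-++ n k (f ∘ suc))) (sym (+-assoc (f 0) _ _))

sum-scale : ∀ n c (f : ℕ → ℕ) → ∑[ i < n ] (c * f i) ≡ c * sumBelow n f
sum-scale zero    c f = sym (*-zeroʳ c)
sum-scale (suc n) c f =
  trans (cong (c * f 0 +_) (sum-scale n c (f ∘ suc))) (sym (*-distribˡ-+ c (f 0) _))

summand≤sum : ∀ n (f : ℕ → ℕ) i → i < n → f i ≤ sumBelow n f
summand≤sum (suc n) f zero    _         = m≤m+n (f 0) _
summand≤sum (suc n) f (suc i) (s≤s i<n) = m≤n⇒m≤o+n (f 0) (summand≤sum n (f ∘ suc) i i<n)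

sum-evenOdd : ∀ M (f : ℕ → ℕ) →
              sumBelow (2 * M) f ≡ ∑[ j < M ] f (2 * j) + ∑[ j < M ] f (suc (2 * j))
sum-evenOdd zero    f = refl
sum-evenOdd (suc M) f = begin
  sumBelow (2 * suc M) f
    ≡⟨ cong (λ n → sumBelow n f) (*-suc 2 M) ⟩
  f 0 + (f 1 + sumBelow (2 * M) (f ∘ suc ∘ suc))
    ≡⟨ cong (λ x → f 0 + (f 1 + x)) (sum-evenOdd M (f ∘ suc ∘ suc)) ⟩
  f 0 + (f 1 + (E + O))
    ≡⟨ solve 4 (λ a b e o → a :+ (b :+ (e :+ o)) := (a :+ e) :+ (b :+ o)) refl (f 0) (f 1) E O ⟩
  (f 0 + E) + (f 1 + O)
    ≡⟨ cong₂ (λ x y → (f 0 + x) + (f 1 + y))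
             (sum-cong M (λ j _ → cong f (sym (*-suc 2 j))))
             (sum-cong M (λ j _ → cong (f ∘ suc) (sym (*-suc 2 j)))) ⟩
  (f 0 + ∑[ j < M ] f (2 * suc j)) + (f 1 + ∑[ j < M ] f (suc (2 * suc j)))
    ∎
  where
  open +-*-Solver
  E O : ℕ
  E = ∑[ j < M ] f (suc (suc (2 * j)))
  O = ∑[ j < M ] f (suc (suc (suc (2 * j))))

contrib : ℕ → ℕ → ℕ
contrib n d = if does (d ∣? n) then d else 0

contrib-∣ : ∀ {n d} → d ∣ n → contrib n d ≡ d
contrib-∣ {n} {d} d∣n with d ∣? n
... | yes _   = refl
... | no  d∤n = contradiction d∣n d∤n

contrib-∤ : ∀ {n d} → d ∤ n → contrib n d ≡ 0
contrib-∤ {n} {d} d∤n with d ∣? n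
... | yes d∣n = contradiction d∣n d∤n
... | no  _   = refl

sum-filter-∣ : ∀ n k (g : ℕ → ℕ) →
               sum (filter (_∣? n) (applyUpTo g k)) ≡ ∑[ i < k ] contrib n (g i)
sum-filter-∣ n zero    g = refl
sum-filter-∣ n (suc k) g with does (g 0 ∣? n)
... | true  = cong (g 0 +_) (sum-filter-∣ n k (g ∘ suc))
... | false = sum-filter-∣ n k (g ∘ suc)

σ-as-sum : ∀ n → σ n ≡ ∑[ i < n ] contrib n (suc i)
σ-as-sum n = trans (cong (sum ∘ filter (_∣? n)) (map-applyUpTo (λ i → i) suc n))
                   (sum-filter-∣ n n suc)

-- For n ≠ 0 the range may be extended beyond n: no d > n divides n.
σ-as-longer-sum : ∀ {n L} .{{_ : NonZero n}} → n ≤ L → σ n ≡ ∑[ i < L ] contrib n (suc i)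
σ-as-longer-sum {n} {L} n≤L = begin
  σ n
    ≡⟨ σ-as-sum n ⟩
  Below
    ≡⟨ +-identityʳ Below ⟨
  Below + 0
    ≡⟨ cong (Below +_) (sum-zero (L ∸ n) (λ i _ → contrib-∤ (>⇒∤ (s≤s (m≤m+n n i))))) ⟨
  Below + ∑[ i < L ∸ n ] contrib n (suc (n + i))
    ≡⟨ sum-++ n (L ∸ n) (contrib n ∘ suc) ⟨
  ∑[ i < n + (L ∸ n) ] contrib n (suc i)
    ≡⟨ cong (λ l → ∑[ i < l ] contrib n (suc i)) (m+[n∸m]≡n n≤L) ⟩
  ∑[ i < L ] contrib n (suc i)
    ∎
  where
  Below : ℕ
  Below = ∑[ i < n ] contrib n (suc i)

-- σ n ≥ n, because n contributes itself (the last summand).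
n≤σn : ∀ n → n ≤ σ n
n≤σn zero    = z≤n
n≤σn (suc n) = subst (suc n ≤_) (sym (σ-as-sum (suc n)))
  (≤-trans (≤-reflexive (sym (contrib-∣ {suc n} {suc n} ∣-refl)))
           (summand≤sum (suc n) (contrib (suc n) ∘ suc) n ≤-refl))

odd-∤ : ∀ j → 2 ∤ suc (2 * j)
odd-∤ j (divides q eq) = even≢odd q j (sym (trans eq (*-comm q 2)))

odd⇒nonZero : ∀ {m} → 2 ∤ m → NonZero m
odd⇒nonZero 2∤m = ≢-nonZero (λ { refl → 2∤m (divides 0 refl) })

odd⇒coprime-2 : ∀ {d} → 2 ∤ d → Coprime d 2
odd⇒coprime-2 2∤d (e∣d , e∣2) with irreducible[2] e∣2
... | inj₁ e≡1    = e≡1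
... | inj₂ refl   = contradiction e∣d 2∤d

odd-∣-2^k* : ∀ {d m} → 2 ∤ d → ∀ k → d ∣ 2 ^ k * m → d ∣ m
odd-∣-2^k* {d} {m} 2∤d zero    d∣ = subst (d ∣_) (*-identityˡ m) d∣
odd-∣-2^k* {d} {m} 2∤d (suc k) d∣ = odd-∣-2^k* 2∤d k
  (coprime-divisor (odd⇒coprime-2 2∤d) (subst (d ∣_) (*-assoc 2 (2 ^ k) m) d∣))

contrib-odd : ∀ m k j → contrib (2 ^ k * m) (suc (2 * j)) ≡ contrib m (suc (2 * j))
contrib-odd m k j with suc (2 * j) ∣? m
... | yes d∣m = trans (contrib-∣ (∣-trans d∣m (n∣m*n (2 ^ k)))) (sym (contrib-∣ d∣m))
... | no  d∤m = trans (contrib-∤ (d∤m ∘ odd-∣-2^k* (odd-∤ j) k)) (sym (contrib-∤ d∤m))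

contrib-double : ∀ M d → contrib (2 * M) (2 * d) ≡ 2 * contrib M d
contrib-double M d with d ∣? M
... | yes d∣M = contrib-∣ (*-monoʳ-∣ 2 d∣M)
... | no  d∤M = contrib-∤ (d∤M ∘ *-cancelˡ-∣ 2)

contrib-even : ∀ {m} → 2 ∤ m → ∀ j → contrib m (2 * suc j) ≡ 0
contrib-even 2∤m j = contrib-∤ (2∤m ∘ ∣-trans (divides (suc j) (*-comm 2 (suc j))))

σ-odd-as-sum : ∀ {m L} → 2 ∤ m → m ≤ 2 * L → σ m ≡ ∑[ j < L ] contrib m (suc (2 * j))
σ-odd-as-sum {m} {L} 2∤m m≤2L = begin
  σ m
    ≡⟨ σ-as-longer-sum {{odd⇒nonZero 2∤m}} m≤2L ⟩
  ∑[ i < 2 * L ] contrib m (suc i)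
    ≡⟨ sum-evenOdd L (contrib m ∘ suc) ⟩
  Odd + ∑[ j < L ] contrib m (suc (suc (2 * j)))
    ≡⟨ cong (Odd +_) (sum-zero L (λ j _ → trans (cong (contrib m) (sym (*-suc 2 j)))
                                                (contrib-even 2∤m j))) ⟩
  Odd + 0
    ≡⟨ +-identityʳ Odd ⟩
  Odd
    ∎
  where
  Odd : ℕ
  Odd = ∑[ j < L ] contrib m (suc (2 * j))

-- Doubling: the odd divisors of 2M = 2^(k+1) m are those of m, the even
-- ones are twice the divisors of M.
σ-double : ∀ {m} → 2 ∤ m → ∀ k → σ (2 * (2 ^ k * m)) ≡ σ m + 2 * σ (2 ^ k * m)
σ-double {m} 2∤m k = begin
  σ (2 * M)
    ≡⟨ σ-as-sum (2 * M) ⟩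
  ∑[ i < 2 * M ] contrib (2 * M) (suc i)
    ≡⟨ sum-evenOdd M (contrib (2 * M) ∘ suc) ⟩
  ∑[ j < M ] contrib (2 * M) (suc (2 * j)) + ∑[ j < M ] contrib (2 * M) (suc (suc (2 * j)))
    ≡⟨ cong₂ _+_ (sum-cong M odd-part) (sum-cong M even-part) ⟩
  ∑[ j < M ] contrib m (suc (2 * j)) + ∑[ j < M ] (2 * contrib M (suc j))
    ≡⟨ cong₂ _+_ (sym (σ-odd-as-sum {L = M} 2∤m m≤2M)) (sum-scale M 2 (contrib M ∘ suc)) ⟩
  σ m + 2 * ∑[ j < M ] contrib M (suc j)
    ≡⟨ cong (λ x → σ m + 2 * x) (σ-as-sum M) ⟨
  σ m + 2 * σ M
    ∎
  where
  M : ℕ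
  M = 2 ^ k * m
  2M≡ : 2 * M ≡ 2 ^ suc k * m
  2M≡ = sym (*-assoc 2 (2 ^ k) m)
  m≤2M : m ≤ 2 * M
  m≤2M = subst (m ≤_) (sym 2M≡) (m≤n*m m (2 ^ suc k) {{m^n≢0 2 (suc k)}})
  odd-part : ∀ j → j < M → contrib (2 * M) (suc (2 * j)) ≡ contrib m (suc (2 * j))
  odd-part j _ = trans (cong (λ n → contrib n (suc (2 * j))) 2M≡) (contrib-odd m (suc k) j)
  even-part : ∀ j → j < M → contrib (2 * M) (suc (suc (2 * j))) ≡ 2 * contrib M (suc j)
  even-part j _ = trans (cong (contrib (2 * M)) (sym (*-suc 2 j))) (contrib-double M (suc j))

σ-2^k* : ∀ {m} → 2 ∤ m → ∀ k → σ (2 ^ k * m) + σ m ≡ 2 ^ suc k * σ m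
σ-2^k* {m} 2∤m zero = begin
  σ (1 * m) + σ m   ≡⟨ cong (λ n → σ n + σ m) (*-identityˡ m) ⟩
  σ m + σ m         ≡⟨ cong (σ m +_) (+-identityʳ (σ m)) ⟨
  2 * σ m           ∎
σ-2^k* {m} 2∤m (suc k) = begin
  σ (2 ^ suc k * m) + σ m          ≡⟨ cong (λ n → σ n + σ m) (*-assoc 2 (2 ^ k) m) ⟩
  σ (2 * (2 ^ k * m)) + σ m        ≡⟨ cong (_+ σ m) (σ-double 2∤m k) ⟩
  σ m + 2 * σ (2 ^ k * m) + σ m    ≡⟨ solve 2 (λ s t → s :+ con 2 :* t :+ s := con 2 :* (t :+ s)) refl (σ m) (σ (2 ^ k * m)) ⟩
  2 * (σ (2 ^ k * m) + σ m)        ≡⟨ cong (2 *_) (σ-2^k* 2∤m k) ⟩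
  2 * (2 ^ suc k * σ m)            ≡⟨ *-assoc 2 (2 ^ suc k) (σ m) ⟨
  2 ^ suc (suc k) * σ m            ∎
  where open +-*-Solver

-- If X + s = P s and X + 1 = P B with B ≤ s and P = q + 1, then
-- q (s − B) = B − 1; here X = σ(2^r B), s = σ(B) and P = 2^(r+1).
divisibility-from-equations : ∀ P .{{_ : NonZero P}} {X s B} → B ≤ s →
  X + s ≡ P * s → X + 1 ≡ P * B → (s ∸ B) ∣ (B ∸ 1)
divisibility-from-equations (suc q) {X} {s} {B} B≤s X+s≡ X+1≡ =
  divides q (cong (_∸ 1) (sym (+-cancelˡ-≡ (q * B) _ _ key)))
  where
  open +-*-Solver
  e : ℕ
  e = s ∸ B
  s≡ : s ≡ B + e
  s≡ = sym (m+[n∸m]≡n B≤s)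
  X≡ : X ≡ q * s
  X≡ = +-cancelʳ-≡ s X (q * s) (trans X+s≡ (+-comm s (q * s)))
  key : q * B + suc (q * e) ≡ q * B + B
  key = begin
    q * B + suc (q * e)   ≡⟨ solve 3 (λ q b e → q :* b :+ (con 1 :+ q :* e) := q :* (b :+ e) :+ con 1) refl q B e ⟩
    q * (B + e) + 1       ≡⟨ cong (λ x → q * x + 1) s≡ ⟨
    q * s + 1             ≡⟨ cong (_+ 1) X≡ ⟨
    X + 1                 ≡⟨ X+1≡ ⟩
    B + q * B             ≡⟨ +-comm B (q * B) ⟩
    q * B + B             ∎

coprime-∣-^ : ∀ {d b} → Coprime d b → ∀ k → d ∣ b ^ k → d ∣ 1
coprime-∣-^ c zero    d∣ = d∣
coprime-∣-^ c (suc k) d∣ = coprime-∣-^ c k (coprime-divisor c d∣)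

lemma4 : (r b : ℕ) → 1 ≤ r → 1 < b → gcd 2 b ≡ 1
    → AlmostPerfect (2 ^ r * b ^ 2)
    → (σ (b ^ 2) ∸ b ^ 2) ∣ (b ^ 2 ∸ 1)
lemma4 r b _ _ gcd≡1 (0<N , σN≡) =
  divisibility-from-equations (2 ^ suc r) {{m^n≢0 2 (suc r)}} (n≤σn B)
    (σ-2^k* B-odd r) σN+1≡
  where
  B : ℕ
  B = b ^ 2
  B-odd : 2 ∤ B
  B-odd 2∣B = contradiction (coprime-∣-^ (gcd≡1⇒coprime {2} {b} gcd≡1) 2 2∣B)
                            (>⇒∤ (s≤s (s≤s z≤n)))
  σN+1≡ : σ (2 ^ r * B) + 1 ≡ 2 ^ suc r * B
  σN+1≡ = begin
    σ (2 ^ r * B) + 1          ≡⟨ cong (_+ 1) σN≡ ⟩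
    2 * (2 ^ r * B) ∸ 1 + 1    ≡⟨ m∸n+n≡m (≤-trans 0<N (m≤n*m _ 2)) ⟩
    2 * (2 ^ r * B)            ≡⟨ *-assoc 2 (2 ^ r) B ⟨
    2 ^ suc r * B              ∎
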